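{- Every minimal sequent is derivable in the system $\mathbf{Mp}$.
   Context: Formulas are built from literals, namely propositional variables $P$ and their complements $\bar P$, using $\wedge$ and $\vee$. Negation satisfies $\neg P=\bar P$ and $\neg\bar P=P$, and is extended by De Morgan's laws. A sequent is a nonempty finite multiset of formulas. A comma denotes multiset union, and $\Gamma,\Delta,\Sigma$ denote possibly empty multisets. A sequent $A_1,\dots,A_n$ is valid if $A_1\vee\cdots\vee A_n$ evaluates to $1$ under every $0/1$-assignment, with $\bar P$ read as the complement of $P$. A sequent is minimal if it is valid and no sequent obtained from it by deleting at least one formula is valid. The system $\mathbf{Mp}$ has the following rules: - Axiom: infer $P,\neg P$ from no premises, for each propositional variable $P$. - $(\wedge)$: from $\Gamma,\Delta,A$ and $\Gamma,\Sigma,B$ infer $\Gamma,\Delta,\Sigma,A\wedge B$. - $(\mathrm{par})$: from $\Gamma,A,B$ infer $\Gamma,A\vee B$. - $(\oplus_i)$ for $i=1,2$: from $\Gamma,A_i$ infer $\Gamma,A_1\vee A_2$. -}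

module Defs where

open import Data.Nat using (ℕ; _<_)
open import Data.Bool using (Bool; true; false; not; _∧_; _∨_)
open import Data.List using (List; []; _∷_; _++_; length)
open import Data.List.Relation.Binary.Permutation.Propositional using (_↭_)
open import Data.List.Relation.Binary.Sublist.Propositional using (_⊆_)
open import Relation.Binary.PropositionalEquality using (_≡_)
open import Relation.Nullary using (¬_)
open import Data.Product using (_×_)
open import Data.Empty using (⊥)
open import Data.Unit using (⊤)

data Formula : Set where
  pos  : ℕ → Formula
  neg  : ℕ → Formula
  _⊗_  : Formula → Formula → Formula   -- conjunction A ∧ B
  _⅋_  : Formula → Formula → Formula   -- disjunction A ∨ B

infixr 6 _⊗_
infixr 5 _⅋_

∼_ : Formula → Formula
∼ pos P   = neg P
∼ neg P   = pos P
∼ (A ⊗ B) = (∼ A) ⅋ (∼ B)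
∼ (A ⅋ B) = (∼ A) ⊗ (∼ B)

-- Sequents: finite multisets of formulas, represented as lists
-- considered up to permutation (the exchange rule below).
Sequent : Set
Sequent = List Formula

Assignment : Set
Assignment = ℕ → Bool

eval : Assignment → Formula → Bool
eval v (pos P) = v P
eval v (neg P) = not (v P)
eval v (A ⊗ B) = eval v A ∧ eval v B
eval v (A ⅋ B) = eval v A ∨ eval v B

evalSeq : Assignment → Sequent → Bool
evalSeq v []       = false
evalSeq v (A ∷ Γ)  = eval v A ∨ evalSeq v Γ

Valid : Sequent → Set
Valid Γ = ∀ (v : Assignment) → evalSeq v Γ ≡ true

NonEmpty : Sequent → Set
NonEmpty [] = ⊥
NonEmpty (_ ∷ _) = ⊤

Minimal : Sequent → Set
Minimal Γ = NonEmpty Γ × Valid Γ × (∀ Δ → Δ ⊆ Γ → length Δ < length Γ → ¬ Valid Δ)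

data Mp : Sequent → Set where
  ax   : ∀ P → Mp (pos P ∷ ∼ pos P ∷ [])
  exch : ∀ {Γ Δ} → Γ ↭ Δ → Mp Γ → Mp Δ
  and  : ∀ Γ Δ Σ A B → Mp (Γ ++ Δ ++ A ∷ []) → Mp (Γ ++ Σ ++ B ∷ [])
       → Mp (Γ ++ Δ ++ Σ ++ (A ⊗ B) ∷ [])
  par  : ∀ Γ A B → Mp (Γ ++ A ∷ B ∷ []) → Mp (Γ ++ (A ⅋ B) ∷ [])
  ⊕₁   : ∀ Γ A B → Mp (Γ ++ A ∷ []) → Mp (Γ ++ (A ⅋ B) ∷ [])
  ⊕₂   : ∀ Γ A B → Mp (Γ ++ B ∷ []) → Mp (Γ ++ (A ⅋ B) ∷ [])

-- Induction on the total size of a minimal sequent Γ.  If Γ consists of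
-- literals, validity forces a complementary pair P, P̄ in Γ, and
-- minimality forces Γ to be exactly that axiom.  Otherwise write
-- Γ = L, C with C compound; minimality of Γ says that L is not valid and
-- that no proper sublist Δ of L makes Δ, C valid.
--   C = A ∨ B: if L, A (or L, B) is valid it is minimal, so (⊕ᵢ) applies;
--   otherwise L, A, B is minimal and (par) applies.
--   C = A ∧ B: both L, A and L, B are valid and contain minimal valid
--   sequents Δ₁, A and Δ₂, B with Δᵢ ⊆ L.  Writing Δ₁ = Γ₀, Δ and
--   Δ₂ = Γ₀, Σ with Γ₀ the common part, the sequent Γ₀, Δ, Σ, A ∧ B is a
--   valid sub-sequent of Γ, hence equals Γ, and (∧) applies.
-- The case split on the validity of L, A and the choice of minimal valid
-- sub-sequents are constructive because validity is decidable: a sequent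
-- depends only on finitely many variables.
module Submission where

open import Defs
open import Data.Bool using (Bool; true; false; not; _∧_; _∨_)
import Data.Bool as Bool
open import Data.Bool.Properties using (∨-zeroʳ)
open import Data.Fin using (zero; suc)
open import Data.Fin.Properties using (any?)
open import Data.List using ([]; _∷_; _++_; [_]; length; map; removeAt)
open import Data.List.Properties
  using (++-cancelˡ; ++-assoc; ++-identityʳ; ∷ʳ-injectiveˡ; map-++; length-removeAt′)
open import Data.List.Membership.Propositional using (_∈_; find)
open import Data.List.Relation.Unary.All using (All; []; _∷_)
import Data.List.Relation.Unary.All as All
open import Data.List.Relation.Unary.Any using (Any; here; there)
import Data.List.Relation.Unary.Any as Any
open import Data.List.Relation.Binary.Equality.Propositional using (≋⇒≡)
open import Data.List.Relation.Binary.Sublist.Propositional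
  using (_⊆_; []; _∷_; _∷ʳ_; from∈; ⊆-refl; ⊆-trans)
open import Data.List.Relation.Binary.Sublist.Propositional.Properties
  using (length-mono-≤; to-≋; ++⁺; Any-resp-⊆)
import Data.List.Relation.Binary.Sublist.Propositional.Properties as Sub
open import Data.List.Relation.Binary.Permutation.Propositional
  using (_↭_; ↭-refl; ↭-sym; ↭-trans; ↭-reflexive; module PermutationReasoning)
import Data.List.Relation.Binary.Permutation.Propositional as ↭
open import Data.List.Relation.Binary.Permutation.Propositional.Properties
  using (↭-length; shift; ++⁺ʳ; ∷↭∷ʳ; Any-resp-↭)
import Data.List.Relation.Binary.Permutation.Propositional.Properties as ↭ using (map⁺)
open import Data.Nat using (ℕ; zero; suc; _+_; _⊔_; _<_; _≤_; z≤n; s≤s)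
open import Data.Nat.Properties
  using (_≟_; ≤-refl; ≤-trans; ≤-antisym; ≤-reflexive; <-≤-trans; <-irrefl; ≮⇒≥;
         m≤m⊔n; m≤n⊔m; m≤m+n; m≤n+m; +-identityʳ;
         +-monoʳ-≤; +-monoʳ-<; +-monoˡ-<; +-mono-≤-<; module ≤-Reasoning)
open import Data.Nat.ListAction using (sum)
open import Data.Nat.ListAction.Properties using (sum-++; sum-↭)
open import Data.Nat.Induction using (<-wellFounded)
open import Data.Product using (∃; _×_; _,_; proj₁; proj₂)
open import Data.Sum using (_⊎_; inj₁; inj₂)
import Data.Sum as Sum
open import Data.Unit using (tt)
open import Function using (_∘_; case_of_)
open import Induction.WellFounded using (Acc; acc)
open import Relation.Binary.PropositionalEquality
  using (_≡_; _≢_; refl; sym; trans; cong; cong₂; subst; subst₂)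
open import Relation.Nullary using (¬_; Dec; yes; no; does; contradiction)
open import Relation.Nullary.Decidable using (map′; _×-dec_; dec-true)

private
  variable
    v : Assignment
    A B C : Formula
    Γ Γ′ Δ L : Sequent

∨-true : ∀ a {b} → a ∨ b ≡ true → a ≡ true ⊎ b ≡ true
∨-true true  _ = inj₁ refl
∨-true false h = inj₂ h

∧-true : ∀ a {b} → a ∧ b ≡ true → a ≡ true × b ≡ true
∧-true true h = refl , h

_⊨_ : Assignment → Sequent → Set
v ⊨ Γ = Any (λ A → eval v A ≡ true) Γ

⊨⇒evalSeq : v ⊨ Γ → evalSeq v Γ ≡ true
⊨⇒evalSeq (here h) = cong (_∨ _) h
⊨⇒evalSeq {v} (there {x = A} s) = trans (cong (eval v A ∨_) (⊨⇒evalSeq s)) (∨-zeroʳ _)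

evalSeq⇒⊨ : ∀ Γ → evalSeq v Γ ≡ true → v ⊨ Γ
evalSeq⇒⊨ {v} (A ∷ Γ) h = Sum.[ here , there ∘ evalSeq⇒⊨ Γ ]′ (∨-true (eval v A) h)

valid⇒⊨ : Valid Γ → ∀ v → v ⊨ Γ
valid⇒⊨ ⊨Γ v = evalSeq⇒⊨ _ (⊨Γ v)

⊨⇒valid : (∀ v → v ⊨ Γ) → Valid Γ
⊨⇒valid ⊨Γ v = ⊨⇒evalSeq (⊨Γ v)

valid-↭ : Γ ↭ Γ′ → Valid Γ → Valid Γ′
valid-↭ p ⊨Γ = ⊨⇒valid λ v → Any-resp-↭ p (valid⇒⊨ ⊨Γ v)

valid-⊆ : Δ ⊆ Γ → Valid Δ → Valid Γ
valid-⊆ p ⊨Δ = ⊨⇒valid λ v → Any-resp-⊆ p (valid⇒⊨ ⊨Δ v)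

valid⇒nonEmpty : Valid Γ → NonEmpty Γ
valid⇒nonEmpty {[]}    ⊨Γ = case ⊨Γ (λ _ → false) of λ ()
valid⇒nonEmpty {_ ∷ _} _  = tt

-- A record rather than a Π-type, so that A and C can be inferred from it.
record Entails (A C : Formula) : Set where
  constructor entails
  field
    entailment : ∀ {v} → eval v A ≡ true → eval v C ≡ true

⊨-∷ʳ-entails : Entails A C → ∀ Γ → v ⊨ (Γ ++ [ A ]) → v ⊨ (Γ ++ [ C ])
⊨-∷ʳ-entails A⇒C []      (here h)   = here (Entails.entailment A⇒C h)
⊨-∷ʳ-entails A⇒C []      (there ())
⊨-∷ʳ-entails A⇒C (_ ∷ Γ) (here h)   = here h
⊨-∷ʳ-entails A⇒C (_ ∷ Γ) (there s)  = there (⊨-∷ʳ-entails A⇒C Γ s)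

valid-∷ʳ-entails : ∀ Γ → Entails A C → Valid (Γ ++ [ A ]) → Valid (Γ ++ [ C ])
valid-∷ʳ-entails Γ A⇒C ⊨ΓA = ⊨⇒valid λ v → ⊨-∷ʳ-entails A⇒C Γ (valid⇒⊨ ⊨ΓA v)

entails-⊗ˡ : Entails (A ⊗ B) A
entails-⊗ˡ {A} = entails λ {v} h → proj₁ (∧-true (eval v A) h)

entails-⊗ʳ : Entails (A ⊗ B) B
entails-⊗ʳ {A} = entails λ {v} h → proj₂ (∧-true (eval v A) h)

entails-⅋ˡ : Entails A (A ⅋ B)
entails-⅋ˡ {B = B} = entails λ {v} h → cong (_∨ eval v B) h

entails-⅋ʳ : Entails B (A ⅋ B)
entails-⅋ʳ {A = A} = entails λ {v} h → trans (cong (eval v A ∨_) h) (∨-zeroʳ _)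

⊨-⅋⁺ : ∀ Γ → v ⊨ (Γ ++ A ∷ B ∷ []) → v ⊨ (Γ ++ [ A ⅋ B ])
⊨-⅋⁺ []      (here h)                 = here (cong (_∨ _) h)
⊨-⅋⁺ {v} {A} [] (there (here h))      = here (trans (cong (eval v A ∨_) h) (∨-zeroʳ _))
⊨-⅋⁺ []      (there (there ()))
⊨-⅋⁺ (_ ∷ Γ) (here h)                 = here h
⊨-⅋⁺ (_ ∷ Γ) (there s)                = there (⊨-⅋⁺ Γ s)

⊨-⅋⁻ : ∀ Γ → v ⊨ (Γ ++ [ A ⅋ B ]) → v ⊨ (Γ ++ A ∷ B ∷ [])
⊨-⅋⁻ {v} {A} [] (here h) = Sum.[ here , there ∘ here ]′ (∨-true (eval v A) h)
⊨-⅋⁻ []      (there ())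
⊨-⅋⁻ (_ ∷ Γ) (here h)    = here h
⊨-⅋⁻ (_ ∷ Γ) (there s)   = there (⊨-⅋⁻ Γ s)

valid-⅋⁺ : ∀ Γ → Valid (Γ ++ A ∷ B ∷ []) → Valid (Γ ++ [ A ⅋ B ])
valid-⅋⁺ Γ ⊨Γ = ⊨⇒valid λ v → ⊨-⅋⁺ Γ (valid⇒⊨ ⊨Γ v)

valid-⅋⁻ : ∀ Γ → Valid (Γ ++ [ A ⅋ B ]) → Valid (Γ ++ A ∷ B ∷ [])
valid-⅋⁻ Γ ⊨Γ = ⊨⇒valid λ v → ⊨-⅋⁻ Γ (valid⇒⊨ ⊨Γ v)

⊨-⊗ : ∀ Γ Δ Σ → v ⊨ (Γ ++ Δ ++ [ A ]) → v ⊨ (Γ ++ Σ ++ [ B ]) →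
      v ⊨ (Γ ++ Δ ++ Σ ++ [ A ⊗ B ])
⊨-⊗ (_ ∷ Γ) Δ Σ (here h)  _         = here h
⊨-⊗ (_ ∷ Γ) Δ Σ (there _) (here h)  = here h
⊨-⊗ (_ ∷ Γ) Δ Σ (there s) (there t) = there (⊨-⊗ Γ Δ Σ s t)
⊨-⊗ [] (_ ∷ Δ) Σ (here h)  _        = here h
⊨-⊗ [] (_ ∷ Δ) Σ (there s) t        = there (⊨-⊗ [] Δ Σ s t)
⊨-⊗ [] [] (_ ∷ Σ) _ (here h)        = here h
⊨-⊗ [] [] (_ ∷ Σ) s (there t)       = there (⊨-⊗ [] [] Σ s t)
⊨-⊗ [] [] [] (here a) (here b)      = here (cong₂ _∧_ a b)
⊨-⊗ [] [] [] (there ()) _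
⊨-⊗ [] [] [] _ (there ())

valid-⊗ : ∀ Γ Δ Σ → Valid (Γ ++ Δ ++ [ A ]) → Valid (Γ ++ Σ ++ [ B ]) →
          Valid (Γ ++ Δ ++ Σ ++ [ A ⊗ B ])
valid-⊗ Γ Δ Σ ⊨A ⊨B = ⊨⇒valid λ v → ⊨-⊗ Γ Δ Σ (valid⇒⊨ ⊨A v) (valid⇒⊨ ⊨B v)

_∷ᵥ_ : Bool → Assignment → Assignment
(b ∷ᵥ v) zero    = b
(b ∷ᵥ v) (suc i) = v i

Agree : ℕ → Assignment → Assignment → Set
Agree n v w = ∀ {i} → i < n → v i ≡ w i

DependsBelow : ℕ → (Assignment → Bool) → Set
DependsBelow n p = ∀ {v w} → Agree n v w → p v ≡ p w

all-assignments? : ∀ n (p : Assignment → Bool) → DependsBelow n p → Dec (∀ v → p v ≡ true)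
all-assignments? zero p local =
  map′ (λ eq v → trans (local λ ()) eq) (λ h → h _) (p (λ _ → false) Bool.≟ true)
all-assignments? (suc n) p local =
  map′ combine (λ h → h ∘ (true ∷ᵥ_) , h ∘ (false ∷ᵥ_)) (after true ×-dec after false)
  where
  after : ∀ b → Dec (∀ w → p (b ∷ᵥ w) ≡ true)
  after b = all-assignments? n (λ w → p (b ∷ᵥ w))
              (λ agree → local λ { {zero} _ → refl ; {suc i} (s≤s lt) → agree lt })
  combine : (∀ w → p (true ∷ᵥ w) ≡ true) × (∀ w → p (false ∷ᵥ w) ≡ true) →
            ∀ v → p v ≡ true
  combine (t , f) v = trans (local λ { {zero} _ → refl ; {suc i} _ → refl }) (by-head (v zero))
    where
    by-head : ∀ b → p (b ∷ᵥ (v ∘ suc)) ≡ true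
    by-head true  = t _
    by-head false = f _

varBound : Formula → ℕ
varBound (pos P) = suc P
varBound (neg P) = suc P
varBound (A ⊗ B) = varBound A ⊔ varBound B
varBound (A ⅋ B) = varBound A ⊔ varBound B

seqVarBound : Sequent → ℕ
seqVarBound []      = zero
seqVarBound (A ∷ Γ) = varBound A ⊔ seqVarBound Γ

agree-⊔ˡ : ∀ {m n v w} → Agree (m ⊔ n) v w → Agree m v w
agree-⊔ˡ {m} {n} agree lt = agree (<-≤-trans lt (m≤m⊔n m n))

agree-⊔ʳ : ∀ {m n v w} → Agree (m ⊔ n) v w → Agree n v w
agree-⊔ʳ {m} {n} agree lt = agree (<-≤-trans lt (m≤n⊔m m n))

eval-local : ∀ A → DependsBelow (varBound A) (λ v → eval v A)
eval-local (pos P) agree = agree ≤-refl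
eval-local (neg P) agree = cong not (agree ≤-refl)
eval-local (A ⊗ B) agree =
  cong₂ _∧_ (eval-local A (agree-⊔ˡ agree)) (eval-local B (agree-⊔ʳ agree))
eval-local (A ⅋ B) agree =
  cong₂ _∨_ (eval-local A (agree-⊔ˡ agree)) (eval-local B (agree-⊔ʳ agree))

evalSeq-local : ∀ Γ → DependsBelow (seqVarBound Γ) (λ v → evalSeq v Γ)
evalSeq-local []      agree = refl
evalSeq-local (A ∷ Γ) agree =
  cong₂ _∨_ (eval-local A (agree-⊔ˡ agree)) (evalSeq-local Γ (agree-⊔ʳ agree))

valid? : ∀ Γ → Dec (Valid Γ)
valid? Γ = all-assignments? (seqVarBound Γ) (λ v → evalSeq v Γ) (evalSeq-local Γ)

record Split (Δ xs ys : Sequent) : Set where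
  constructor split
  field
    {prefix suffix} : Sequent
    prefix⊆ : prefix ⊆ xs
    suffix⊆ : suffix ⊆ ys
    splits  : Δ ≡ prefix ++ suffix

⊆-++⁻ : ∀ xs {ys} → Δ ⊆ xs ++ ys → Split Δ xs ys
⊆-++⁻ []       p          = split [] p refl
⊆-++⁻ (x ∷ xs) (.x ∷ʳ p)  with ⊆-++⁻ xs p
... | split q r eq = split (x ∷ʳ q) r eq
⊆-++⁻ (x ∷ xs) (refl ∷ p) with ⊆-++⁻ xs p
... | split q r eq = split (refl ∷ q) r (cong (x ∷_) eq)

⊆-↭ : Γ ↭ Γ′ → Δ ⊆ Γ′ → ∃ λ Δ′ → Δ′ ⊆ Γ × Δ′ ↭ Δ
⊆-↭ ↭.refl q = _ , q , ↭-refl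
⊆-↭ (↭.prep x p) (.x ∷ʳ q) =
  let Δ′ , s , r = ⊆-↭ p q in Δ′ , x ∷ʳ s , r
⊆-↭ (↭.prep x p) (refl ∷ q) =
  let Δ′ , s , r = ⊆-↭ p q in x ∷ Δ′ , refl ∷ s , ↭.prep x r
⊆-↭ (↭.swap x y p) (.y ∷ʳ .x ∷ʳ q) =
  let Δ′ , s , r = ⊆-↭ p q in Δ′ , x ∷ʳ y ∷ʳ s , r
⊆-↭ (↭.swap x y p) (.y ∷ʳ (refl ∷ q)) =
  let Δ′ , s , r = ⊆-↭ p q in x ∷ Δ′ , refl ∷ y ∷ʳ s , ↭.prep x r
⊆-↭ (↭.swap x y p) (refl ∷ .x ∷ʳ q) =
  let Δ′ , s , r = ⊆-↭ p q in y ∷ Δ′ , x ∷ʳ (refl ∷ s) , ↭.prep y r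
⊆-↭ (↭.swap x y p) (refl ∷ refl ∷ q) =
  let Δ′ , s , r = ⊆-↭ p q in x ∷ y ∷ Δ′ , refl ∷ refl ∷ s , ↭.swap x y r
⊆-↭ (↭.trans p₁ p₂) q =
  let Δ₁ , s₁ , r₁ = ⊆-↭ p₂ q
      Δ₂ , s₂ , r₂ = ⊆-↭ p₁ s₁
  in Δ₂ , s₂ , ↭-trans r₂ r₁

record Union (Δ₁ Δ₂ L : Sequent) : Set where
  constructor union
  field
    {joined shared left right} : Sequent
    joined⊆ : joined ⊆ L
    joined↭ : joined ↭ shared ++ left ++ right
    Δ₁↭     : Δ₁ ↭ shared ++ left
    Δ₂↭     : Δ₂ ↭ shared ++ right

⊆-union : ∀ {Δ₁ Δ₂} → Δ₁ ⊆ L → Δ₂ ⊆ L → Union Δ₁ Δ₂ L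
⊆-union [] [] = union {shared = []} {[]} {[]} [] ↭-refl ↭-refl ↭-refl
⊆-union (y ∷ʳ p) (.y ∷ʳ q) with ⊆-union p q
... | union {shared = G} {D} {S} s u r₁ r₂ = union {shared = G} {D} {S} (y ∷ʳ s) u r₁ r₂
⊆-union (refl ∷ p) (refl ∷ q) with ⊆-union p q
... | union {shared = G} {D} {S} s u r₁ r₂ =
  union {shared = _ ∷ G} {D} {S} (refl ∷ s) (↭.prep _ u) (↭.prep _ r₁) (↭.prep _ r₂)
⊆-union (refl ∷ p) (y ∷ʳ q) with ⊆-union p q
... | union {shared = G} {D} {S} s u r₁ r₂ =
  union {shared = G} {y ∷ D} {S} (refl ∷ s) (↭-trans (↭.prep y u) (↭-sym (shift y G (D ++ S))))
                   (↭-trans (↭.prep y r₁) (↭-sym (shift y G D))) r₂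
⊆-union (y ∷ʳ p) (refl ∷ q) with ⊆-union p q
... | union {shared = G} {D} {S} s u r₁ r₂ =
  union {shared = G} {D} {y ∷ S} (refl ∷ s) moved r₁
        (↭-trans (↭.prep y r₂) (↭-sym (shift y G S)))
  where
  open PermutationReasoning
  moved : y ∷ _ ↭ G ++ D ++ y ∷ S
  moved = begin
    y ∷ _                ↭⟨ ↭.prep y u ⟩
    y ∷ G ++ D ++ S      ≡⟨ cong (y ∷_) (++-assoc G D S) ⟨
    y ∷ (G ++ D) ++ S    ↭⟨ shift y (G ++ D) S ⟨
    (G ++ D) ++ y ∷ S    ≡⟨ ++-assoc G D (y ∷ S) ⟩
    G ++ D ++ y ∷ S      ∎

∈-pair-⊆ : ∀ {x y} → x ∈ Γ → y ∈ Γ → x ≢ y →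
           (x ∷ y ∷ [] ⊆ Γ) ⊎ (y ∷ x ∷ [] ⊆ Γ)
∈-pair-⊆ (here refl) (here refl) x≢y = contradiction refl x≢y
∈-pair-⊆ (here refl) (there y∈)  _   = inj₁ (refl ∷ from∈ y∈)
∈-pair-⊆ (there x∈)  (here refl) _   = inj₂ (refl ∷ from∈ x∈)
∈-pair-⊆ (there x∈)  (there y∈)  x≢y = Sum.map (_ ∷ʳ_) (_ ∷ʳ_) (∈-pair-⊆ x∈ y∈ x≢y)

removeAt-⊆ : ∀ (Γ : Sequent) i → removeAt Γ i ⊆ Γ
removeAt-⊆ (x ∷ Γ) zero    = x ∷ʳ ⊆-refl
removeAt-⊆ (x ∷ Γ) (suc i) = refl ∷ removeAt-⊆ Γ i

⊆-removeAt : Δ ⊆ Γ → length Δ < length Γ → ∃ λ i → Δ ⊆ removeAt Γ i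
⊆-removeAt (_ ∷ʳ p)   _        = zero , p
⊆-removeAt (refl ∷ p) (s≤s lt) = let i , q = ⊆-removeAt p lt in suc i , refl ∷ q

minimal⇒valid : Minimal Γ → Valid Γ
minimal⇒valid (_ , ⊨Γ , _) = ⊨Γ

minimal-≡ : Minimal Γ → Δ ⊆ Γ → Valid Δ → Δ ≡ Γ
minimal-≡ (_ , _ , proper-invalid) Δ⊆Γ ⊨Δ =
  ≋⇒≡ (to-≋ (≤-antisym (length-mono-≤ Δ⊆Γ) (≮⇒≥ λ lt → proper-invalid _ Δ⊆Γ lt ⊨Δ))
             Δ⊆Γ)

irredundant⇒minimal : Valid Γ → (∀ {Δ} → Δ ⊆ Γ → Valid Δ → Δ ≡ Γ) → Minimal Γ
irredundant⇒minimal ⊨Γ irredundant =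
  valid⇒nonEmpty ⊨Γ , ⊨Γ ,
  λ _ Δ⊆Γ lt ⊨Δ → <-irrefl (cong length (irredundant Δ⊆Γ ⊨Δ)) lt

minimal-↭ : Γ ↭ Γ′ → Minimal Γ → Minimal Γ′
minimal-↭ {Γ′ = Γ′} p (_ , ⊨Γ , proper-invalid) =
  valid⇒nonEmpty ⊨Γ′ , ⊨Γ′ , λ Δ Δ⊆Γ′ lt ⊨Δ →
    let Δ′ , Δ′⊆Γ , Δ′↭Δ = ⊆-↭ p Δ⊆Γ′
    in proper-invalid Δ′ Δ′⊆Γ (subst₂ _<_ (sym (↭-length Δ′↭Δ)) (sym (↭-length p)) lt)
                      (valid-↭ (↭-sym Δ′↭Δ) ⊨Δ)
  where
  ⊨Γ′ : Valid Γ′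
  ⊨Γ′ = valid-↭ p ⊨Γ

valid⇒minimal-⊆ : ∀ Γ → Valid Γ → ∃ λ Δ → Δ ⊆ Γ × Minimal Δ
valid⇒minimal-⊆ Γ = go Γ (<-wellFounded (length Γ))
  where
  go : ∀ Γ → Acc _<_ (length Γ) → Valid Γ → ∃ λ Δ → Δ ⊆ Γ × Minimal Δ
  go Γ (acc rs) ⊨Γ with any? (λ i → valid? (removeAt Γ i))
  ... | yes (i , ⊨Γ-i) =
    let Δ , Δ⊆ , mΔ = go (removeAt Γ i) (rs (≤-reflexive (sym (length-removeAt′ Γ i)))) ⊨Γ-i
    in Δ , ⊆-trans Δ⊆ (removeAt-⊆ Γ i) , mΔ
  ... | no none = Γ , ⊆-refl , valid⇒nonEmpty ⊨Γ , ⊨Γ , λ _ Δ⊆Γ lt ⊨Δ →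
    let i , Δ⊆Γ-i = ⊆-removeAt Δ⊆Γ lt in none (i , valid-⊆ Δ⊆Γ-i ⊨Δ)

minimal-∷ʳ⇒¬valid : Minimal (L ++ [ C ]) → ¬ Valid L
minimal-∷ʳ⇒¬valid {L} {C} m ⊨L =
  case ++-cancelˡ L [] [ C ] (trans (++-identityʳ L) (minimal-≡ m (Sub.++⁺ʳ [ C ] ⊆-refl) ⊨L))
  of λ ()

¬valid-⊆-++[] : ¬ Valid L → Δ ⊆ L → ¬ Valid (Δ ++ [])
¬valid-⊆-++[] {Δ = Δ} ⊭L Δ⊆L ⊨Δ = ⊭L (valid-⊆ Δ⊆L (subst Valid (++-identityʳ Δ) ⊨Δ))

minimal-∷ʳ-entails : Minimal (L ++ [ C ]) → Entails A C → Valid (L ++ [ A ]) → Minimal (L ++ [ A ])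
minimal-∷ʳ-entails {L} {C} {A} m A⇒C ⊨LA = irredundant⇒minimal ⊨LA irredundant
  where
  irredundant : Δ ⊆ L ++ [ A ] → Valid Δ → Δ ≡ L ++ [ A ]
  irredundant Δ⊆ ⊨Δ with ⊆-++⁻ L Δ⊆
  ... | split a⊆L (_ ∷ʳ [])   refl = contradiction ⊨Δ (¬valid-⊆-++[] (minimal-∷ʳ⇒¬valid m) a⊆L)
  ... | split {a} a⊆L (refl ∷ []) refl = cong (_++ [ A ]) (∷ʳ-injectiveˡ a L
    (minimal-≡ m (++⁺ a⊆L ⊆-refl) (valid-∷ʳ-entails a A⇒C ⊨Δ)))

minimal-⅋⁻ : Minimal (L ++ [ A ⅋ B ]) → ¬ Valid (L ++ [ A ]) → ¬ Valid (L ++ [ B ]) →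
             Minimal (L ++ A ∷ B ∷ [])
minimal-⅋⁻ {L} {A} {B} m ⊭A ⊭B =
  irredundant⇒minimal (valid-⅋⁻ L (minimal⇒valid m)) irredundant
  where
  irredundant : Δ ⊆ L ++ A ∷ B ∷ [] → Valid Δ → Δ ≡ L ++ A ∷ B ∷ []
  irredundant Δ⊆ ⊨Δ with ⊆-++⁻ L Δ⊆
  ... | split a⊆L (_ ∷ʳ _ ∷ʳ [])     refl =
    contradiction ⊨Δ (¬valid-⊆-++[] (minimal-∷ʳ⇒¬valid m) a⊆L)
  ... | split a⊆L (refl ∷ _ ∷ʳ [])   refl = contradiction (valid-⊆ (++⁺ a⊆L ⊆-refl) ⊨Δ) ⊭A
  ... | split a⊆L (_ ∷ʳ (refl ∷ [])) refl = contradiction (valid-⊆ (++⁺ a⊆L ⊆-refl) ⊨Δ) ⊭B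
  ... | split {a} a⊆L (refl ∷ refl ∷ []) refl = cong (_++ A ∷ B ∷ []) (∷ʳ-injectiveˡ a L
    (minimal-≡ m (++⁺ a⊆L ⊆-refl) (valid-⅋⁺ a ⊨Δ)))

minimal-⊆-∷ʳ : ¬ Valid L → Valid (L ++ [ A ]) → ∃ λ Δ → Δ ⊆ L × Minimal (Δ ++ [ A ])
minimal-⊆-∷ʳ {L} {A} ⊭L ⊨LA with valid⇒minimal-⊆ (L ++ [ A ]) ⊨LA
... | _ , M⊆ , mM with ⊆-++⁻ L M⊆
...   | split a⊆L (_ ∷ʳ [])   refl = contradiction (minimal⇒valid mM) (¬valid-⊆-++[] ⊭L a⊆L)
...   | split a⊆L (refl ∷ []) refl = _ , a⊆L , mM

data Literal : Formula → Set where
  pos : ∀ P → Literal (pos P)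
  neg : ∀ P → Literal (neg P)

neg-≟ : ∀ P (A : Formula) → Dec (neg P ≡ A)
neg-≟ P (neg Q) = map′ (cong neg) (λ { refl → refl }) (P ≟ Q)
neg-≟ P (pos _) = no λ ()
neg-≟ P (_ ⊗ _) = no λ ()
neg-≟ P (_ ⅋ _) = no λ ()

-- Makes exactly the variables negated in Γ true: it falsifies every
-- sequent of literals without a complementary pair.
negatedIn : Sequent → Assignment
negatedIn Γ P = does (Any.any? (neg-≟ P) Γ)

negatedIn-true : ∀ Γ P → negatedIn Γ P ≡ true → neg P ∈ Γ
negatedIn-true Γ P with Any.any? (neg-≟ P) Γ
... | yes n∈Γ = λ _ → n∈Γ
... | no  _   = λ ()

complementary-pair : All Literal Γ → Valid Γ → ∃ λ P → pos P ∈ Γ × neg P ∈ Γ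
complementary-pair {Γ} lits ⊨Γ with find (valid⇒⊨ ⊨Γ (negatedIn Γ))
... | A , A∈Γ , A-true with All.lookup lits A∈Γ
...   | pos P = P , A∈Γ , negatedIn-true Γ P A-true
...   | neg P =
  contradiction (trans (cong not (sym (dec-true (Any.any? (neg-≟ P) Γ) A∈Γ))) A-true) λ ()

axiom-valid : ∀ P → Valid (pos P ∷ neg P ∷ [])
axiom-valid P v with v P
... | true  = refl
... | false = refl

literals-derivable : All Literal Γ → Minimal Γ → Mp Γ
literals-derivable lits m with complementary-pair lits (minimal⇒valid m)
... | P , p∈Γ , n∈Γ with ∈-pair-⊆ p∈Γ n∈Γ (λ ())
...   | inj₁ s = subst Mp (minimal-≡ m s (axiom-valid P)) (ax P)
...   | inj₂ s = subst Mp (minimal-≡ m s (valid-↭ swap (axiom-valid P))) (exch swap (ax P))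
  where
  swap : pos P ∷ neg P ∷ [] ↭ neg P ∷ pos P ∷ []
  swap = ↭.swap (pos P) (neg P) ↭-refl

size : Formula → ℕ
size (pos _) = 1
size (neg _) = 1
size (A ⊗ B) = suc (size A + size B)
size (A ⅋ B) = suc (size A + size B)

size-<ˡ : ∀ A B → size A < suc (size A + size B)
size-<ˡ A B = s≤s (m≤m+n (size A) (size B))

size-<ʳ : ∀ A B → size B < suc (size A + size B)
size-<ʳ A B = s≤s (m≤n+m (size B) (size A))

weight : Sequent → ℕ
weight Γ = sum (map size Γ)

weight-++ : ∀ Γ Δ → weight (Γ ++ Δ) ≡ weight Γ + weight Δ
weight-++ Γ Δ = trans (cong sum (map-++ size Γ Δ)) (sum-++ (map size Γ) (map size Δ))

weight-↭ : Γ ↭ Δ → weight Γ ≡ weight Δ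
weight-↭ p = sum-↭ (↭.map⁺ size p)

weight-mono : Δ ⊆ Γ → weight Δ ≤ weight Γ
weight-mono []         = z≤n
weight-mono (A ∷ʳ p)   = ≤-trans (weight-mono p) (m≤n+m _ (size A))
weight-mono (refl ∷ p) = +-monoʳ-≤ (size _) (weight-mono p)

weight-∷ʳ-< : ∀ A C → Δ ⊆ L → size A < size C → weight (Δ ++ [ A ]) < weight (L ++ [ C ])
weight-∷ʳ-< {Δ} {L} A C Δ⊆L A<C = begin-strict
  weight (Δ ++ [ A ])      ≡⟨ weight-++ Δ [ A ] ⟩
  weight Δ + (size A + 0)  <⟨ +-mono-≤-< (weight-mono Δ⊆L) (+-monoˡ-< 0 A<C) ⟩
  weight L + (size C + 0)  ≡⟨ weight-++ L [ C ] ⟨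
  weight (L ++ [ C ])      ∎
  where open ≤-Reasoning

weight-⅋⁻-< : ∀ L → weight (L ++ A ∷ B ∷ []) < weight (L ++ [ A ⅋ B ])
weight-⅋⁻-< {A} {B} L
  rewrite weight-++ L (A ∷ B ∷ []) | weight-++ L [ A ⅋ B ]
        | +-identityʳ (size B) | +-identityʳ (suc (size A + size B))
  = +-monoʳ-< (weight L) ≤-refl

DerivableBelow : Sequent → Set
DerivableBelow Γ = ∀ {Δ} → weight Δ < weight Γ → Minimal Δ → Mp Δ

derivableBelow-↭ : Γ ↭ Γ′ → DerivableBelow Γ → DerivableBelow Γ′
derivableBelow-↭ p ih {Δ} lt = ih (subst (weight Δ <_) (sym (weight-↭ p)) lt)

⅋-derivable : Minimal (L ++ [ A ⅋ B ]) → DerivableBelow (L ++ [ A ⅋ B ]) → Mp (L ++ [ A ⅋ B ])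
⅋-derivable {L} {A} {B} m ih with valid? (L ++ [ A ]) | valid? (L ++ [ B ])
... | yes ⊨A | _ =
  ⊕₁ L A B (ih (weight-∷ʳ-< A (A ⅋ B) (⊆-refl {x = L}) (size-<ˡ A B))
              (minimal-∷ʳ-entails m entails-⅋ˡ ⊨A))
... | no _ | yes ⊨B =
  ⊕₂ L A B (ih (weight-∷ʳ-< B (A ⅋ B) (⊆-refl {x = L}) (size-<ʳ A B))
              (minimal-∷ʳ-entails m entails-⅋ʳ ⊨B))
... | no ⊭A | no ⊭B = par L A B (ih (weight-⅋⁻-< L) (minimal-⅋⁻ m ⊭A ⊭B))

⊗-derivable : Minimal (L ++ [ A ⊗ B ]) → DerivableBelow (L ++ [ A ⊗ B ]) → Mp (L ++ [ A ⊗ B ])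
⊗-derivable {L} {A} {B} m ih
  with minimal-⊆-∷ʳ (minimal-∷ʳ⇒¬valid m) (valid-∷ʳ-entails L entails-⊗ˡ (minimal⇒valid m))
     | minimal-⊆-∷ʳ (minimal-∷ʳ⇒¬valid m) (valid-∷ʳ-entails L entails-⊗ʳ (minimal⇒valid m))
... | Δ₁ , Δ₁⊆L , m₁ | Δ₂ , Δ₂⊆L , m₂ with ⊆-union Δ₁⊆L Δ₂⊆L
... | union {U} {G} {D} {S} U⊆L U↭ Δ₁↭ Δ₂↭ =
  subst (λ Γ → Mp (Γ ++ [ A ⊗ B ])) U≡L (exch (↭-sym U⊗↭) (and G D S A B ⊢A ⊢B))
  where
  Δ₁A↭ : Δ₁ ++ [ A ] ↭ G ++ D ++ [ A ]
  Δ₁A↭ = ↭-trans (++⁺ʳ [ A ] Δ₁↭) (↭-reflexive (++-assoc G D [ A ]))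
  Δ₂B↭ : Δ₂ ++ [ B ] ↭ G ++ S ++ [ B ]
  Δ₂B↭ = ↭-trans (++⁺ʳ [ B ] Δ₂↭) (↭-reflexive (++-assoc G S [ B ]))
  U⊗↭ : U ++ [ A ⊗ B ] ↭ G ++ D ++ S ++ [ A ⊗ B ]
  U⊗↭ = ↭-trans (++⁺ʳ [ A ⊗ B ] U↭)
          (↭-reflexive (trans (++-assoc G (D ++ S) _) (cong (G ++_) (++-assoc D S _))))
  ⊢A : Mp (G ++ D ++ [ A ])
  ⊢A = exch Δ₁A↭ (ih (weight-∷ʳ-< A (A ⊗ B) Δ₁⊆L (size-<ˡ A B)) m₁)
  ⊢B : Mp (G ++ S ++ [ B ])
  ⊢B = exch Δ₂B↭ (ih (weight-∷ʳ-< B (A ⊗ B) Δ₂⊆L (size-<ʳ A B)) m₂)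
  ⊨U : Valid (U ++ [ A ⊗ B ])
  ⊨U = valid-↭ (↭-sym U⊗↭)
         (valid-⊗ G D S (valid-↭ Δ₁A↭ (minimal⇒valid m₁))
                        (valid-↭ Δ₂B↭ (minimal⇒valid m₂)))
  U≡L : U ≡ L
  U≡L = ∷ʳ-injectiveˡ U L (minimal-≡ m (++⁺ U⊆L ⊆-refl) ⊨U)

data Decomposition (Γ : Sequent) : Set where
  literals : All Literal Γ → Decomposition Γ
  ⊗-last   : ∀ L A B → Γ ↭ L ++ [ A ⊗ B ] → Decomposition Γ
  ⅋-last   : ∀ L A B → Γ ↭ L ++ [ A ⅋ B ] → Decomposition Γ

cons-literal : Literal A → Decomposition Γ → Decomposition (A ∷ Γ)
cons-literal     l (literals lits)  = literals (l ∷ lits)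
cons-literal {A} l (⊗-last L B C p) = ⊗-last (A ∷ L) B C (↭.prep A p)
cons-literal {A} l (⅋-last L B C p) = ⅋-last (A ∷ L) B C (↭.prep A p)

decompose : ∀ Γ → Decomposition Γ
decompose []            = literals []
decompose (pos P ∷ Γ)   = cons-literal (pos P) (decompose Γ)
decompose (neg P ∷ Γ)   = cons-literal (neg P) (decompose Γ)
decompose ((A ⊗ B) ∷ Γ) = ⊗-last Γ A B (∷↭∷ʳ _ Γ)
decompose ((A ⅋ B) ∷ Γ) = ⅋-last Γ A B (∷↭∷ʳ _ Γ)

minimal-derivable-step : Minimal Γ → DerivableBelow Γ → Mp Γ
minimal-derivable-step {Γ} m ih with decompose Γ
... | literals lits  = literals-derivable lits m
... | ⊗-last L A B p = exch (↭-sym p) (⊗-derivable (minimal-↭ p m) (derivableBelow-↭ p ih))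
... | ⅋-last L A B p = exch (↭-sym p) (⅋-derivable (minimal-↭ p m) (derivableBelow-↭ p ih))

minimal-derivable : ∀ Γ → Acc _<_ (weight Γ) → Minimal Γ → Mp Γ
minimal-derivable Γ (acc rs) m = minimal-derivable-step m λ {Δ} lt → minimal-derivable Δ (rs lt)

proposition7 : ∀ (Γ : Sequent) → Minimal Γ → Mp Γ
proposition7 Γ = minimal-derivable Γ (<-wellFounded (weight Γ))
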